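{- Let $\mathcal F$ be a Fano plane and $\mathbb F$ a field of characteristic not $2$. (a) Let $n'\in V_{\mathcal F}^\ast$ and let $\epsilon'$ be a multiplication factor such that $(\mathbb O_{\mathcal F},e^{n'},\epsilon')$ is a composition algebra. Define $\epsilon_{PQ}=(-1)^{n'(P)n'(Q)}\epsilon'_{PQ}$ for all $P\ne Q$ in $\mathcal F$. Then $(\mathbb O_{\mathcal F},\mathbf 1,\epsilon)$ is a composition algebra. (b) Let $\epsilon$ be a multiplication factor such that $(\mathbb O_{\mathcal F},\mathbf 1,\epsilon)$ is a composition algebra, let $n'\in V_{\mathcal F}^\ast$, and define $\epsilon'_{PQ}=(-1)^{n'(P)n'(Q)}\epsilon_{PQ}$ for all $P\ne Q$ in $\mathcal F$. Then $(\mathbb O_{\mathcal F},e^{n'},\epsilon')$ is a composition algebra.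
   Context: A Fano plane is a set $\mathcal F$ of seven points together with a set of seven $3$-element subsets of $\mathcal F$ called lines, such that any two distinct points lie in a unique line and any two distinct lines meet in a unique point. The Fano cube is $V_{\mathcal F}=\mathcal F\cup\{0\}$ with the unique $\mathbb Z_2$-vector space structure with zero $0$ such that for distinct $P,Q\in\mathcal F$, $P+Q$ is the third point of the line through $P$ and $Q$; $V_{\mathcal F}^\ast$ is its dual. A norm on $\mathcal F$ is a map $N:\mathcal F\to\{ -1,1\}$ with $N(P+Q)=N(P)N(Q)$ for $P\ne Q$; for $n\in V_{\mathcal F}^\ast$, $e^{n}$ denotes the norm $P\mapsto(-1)^{n(P)}$, and $\mathbf 1=e^0$ is the trivial norm. A multiplication factor is a map $\epsilon:\{(P,Q)\in\mathcal F^2:P\ne Q\}\to\{ -1,1\}$ with $\epsilon_{QP}=-\epsilon_{PQ}$. $\mathbb O_{\mathcal F}$ is the $\mathbb F$-vector space of $\mathbb F$-valued functions on $V_{\mathcal F}$, with basis $e_P$ ($P\in V_{\mathcal F}$), $e_P$ the indicator function of $P$. Given a norm $N$ and $\epsilon$, the multiplication $\cdot_\epsilon$ is bilinear with $e_P\cdot_\epsilon e_Q=\epsilon_{PQ}e_{P+Q}$ for $P\ne Q$ in $\mathcal F$, $e_P\cdot_\epsilon e_P=-N(P)e_0$ for $P\in\mathcal F$, and $e_0$ a two-sided unit; the quadratic form is $N_{\mathbb O}(\lambda^0e_0+\sum_P\lambda^Pe_P)=(\lambda^0)^2+\sum_PN(P)(\lambda^P)^2$. $(\mathbb O_{\mathcal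 F},N,\epsilon)$ is a composition algebra iff $N_{\mathbb O}(Z\cdot_\epsilon W)=N_{\mathbb O}(Z)N_{\mathbb O}(W)$ for all $Z,W\in\mathbb O_{\mathcal F}$. -}

module Defs where

open import Level using (Level; _⊔_; suc)
open import Data.Fin using (Fin)
open import Data.Fin.Properties using (any?) renaming (_≟_ to _≟ᶠ_)
open import Data.Maybe using (Maybe; just; nothing)
open import Data.Bool using (Bool; true; false; _xor_; _∧_; if_then_else_)
open import Data.Sign using (Sign; opposite) renaming (_*_ to _*ˢ_; + to s+; - to s-)
open import Data.Product using (Σ; ∃; ∃!; _×_; _,_; proj₁)
open import Data.Sum using (_⊎_)
open import Relation.Nullary using (¬_; Dec; yes; no)
open import Relation.Nullary.Decidable using (_×-dec_; ¬?)
open import Relation.Binary.PropositionalEquality using (_≡_; _≢_; refl; cong; sym; trans)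
open import Relation.Binary.Definitions using (DecidableEquality)
open import Function.Bundles using (_↔_; Inverse)
open import Algebra.Bundles using (CommutativeRing)
import Algebra.Properties.Monoid.Sum as MonoidSum

record Field (c ℓ : Level) : Set (suc (c ⊔ ℓ)) where
  field
    commutativeRing : CommutativeRing c ℓ
  open CommutativeRing commutativeRing public
  field
    0≉1     : ¬ (0# ≈ 1#)
    inverse : ∀ x → ¬ (x ≈ 0#) → ∃ λ y → x * y ≈ 1#

CharNot2 : ∀ {c ℓ} → Field c ℓ → Set ℓ
CharNot2 F = ¬ (1# + 1# ≈ 0#)
  where open Field F

record FanoPlane : Set₁ where
  field
    Point    : Set
    Line     : Set
    _∈ₗ_     : Point → Line → Set
    _∈ₗ?_    : ∀ P l → Dec (P ∈ₗ l)
    points   : Fin 7 ↔ Point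
    lines    : Fin 7 ↔ Line
    threePts : ∀ l → Σ Point λ P → Σ Point λ Q → Σ Point λ R →
                 (P ≢ Q × P ≢ R × Q ≢ R) × (P ∈ₗ l × Q ∈ₗ l × R ∈ₗ l) ×
                 (∀ S → S ∈ₗ l → S ≡ P ⊎ S ≡ Q ⊎ S ≡ R)
    joinUnique : ∀ P Q → P ≢ Q → ∃! _≡_ λ l → P ∈ₗ l × Q ∈ₗ l
    meetUnique : ∀ l m → l ≢ m → ∃! _≡_ λ P → P ∈ₗ l × P ∈ₗ m

  pt : Fin 7 → Point
  pt = Inverse.to points

  ln : Fin 7 → Line
  ln = Inverse.to lines

  _≟ₚ_ : DecidableEquality Point
  P ≟ₚ Q with Inverse.from points P ≟ᶠ Inverse.from points Q
  ... | yes e = yes (trans (sym (Inverse.strictlyInverseˡ points P))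
                     (trans (cong (Inverse.to points) e) (Inverse.strictlyInverseˡ points Q)))
  ... | no ne = no λ e → ne (cong (Inverse.from points) e)

  Collinear : Point → Point → Point → Set
  Collinear P Q R = ∃ λ i → P ∈ₗ ln i × Q ∈ₗ ln i × R ∈ₗ ln i

  collinear? : ∀ P Q R → Dec (Collinear P Q R)
  collinear? P Q R = any? λ i → (P ∈ₗ? ln i) ×-dec (Q ∈ₗ? ln i) ×-dec (R ∈ₗ? ln i)

  -- the third point on the line through P and Q (for P ≠ Q; the axioms
  -- guarantee the search succeeds, the fallback is never used)
  third : Point → Point → Point
  third P Q with any? (λ i → ¬? (pt i ≟ₚ P) ×-dec ¬? (pt i ≟ₚ Q) ×-dec collinear? P Q (pt i))
  ... | yes (i , _) = pt i
  ... | no _ = P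

  -- The Fano cube V_F = F ∪ {0}, with 0 represented by nothing.
  V : Set
  V = Maybe Point

  infixl 6 _⊕_
  _⊕_ : V → V → V
  nothing ⊕ y = y
  just P ⊕ nothing = just P
  just P ⊕ just Q with P ≟ₚ Q
  ... | yes _ = nothing
  ... | no _ = just (third P Q)

  _≟ᵥ_ : DecidableEquality V
  nothing ≟ᵥ nothing = yes refl
  nothing ≟ᵥ just _ = no λ ()
  just _ ≟ᵥ nothing = no λ ()
  just P ≟ᵥ just Q with P ≟ₚ Q
  ... | yes refl = yes refl
  ... | no ne = no λ { refl → ne refl }

  -- Elements of the dual space V_F^* (linear maps V_F → ℤ₂, ℤ₂ = Bool
  -- with xor as addition).
  record Dual : Set where
    field
      fun      : V → Bool
      additive : ∀ x y → fun (x ⊕ y) ≡ fun x xor fun y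

  NormMap : Set
  NormMap = Point → Sign

  IsNorm : NormMap → Set
  IsNorm N = ∀ P Q → P ≢ Q → N (third P Q) ≡ N P *ˢ N Q

  signOf : Bool → Sign
  signOf true  = s-
  signOf false = s+

  expN : Dual → NormMap
  expN n P = signOf (Dual.fun n (just P))

  oneN : NormMap
  oneN _ = s+

  MultFactor : Set
  MultFactor = (P Q : Point) → .(P ≢ Q) → Sign

  IsMultFactor : MultFactor → Set
  IsMultFactor ε = ∀ P Q (d : P ≢ Q) → ε Q P (λ e → d (sym e)) ≡ opposite (ε P Q d)

  twist : Dual → MultFactor → MultFactor
  twist n ε P Q d = signOf (Dual.fun n (just P) ∧ Dual.fun n (just Q)) *ˢ ε P Q d

  module Octonions {c ℓ} (𝔽 : Field c ℓ) where
    open Field 𝔽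
    open MonoidSum +-monoid using (sum)

    -- elements of O_F: 𝔽-valued functions on V_F
    O : Set c
    O = V → Carrier

    signF : Sign → Carrier
    signF s+ = 1#
    signF s- = - 1#

    sumP : (Point → Carrier) → Carrier
    sumP f = sum (λ i → f (pt i))

    sumV : (V → Carrier) → Carrier
    sumV f = f nothing + sumP (λ P → f (just P))

    -- coefficient c with e_A · e_B = c e_{A+B}
    coeff : NormMap → MultFactor → V → V → Carrier
    coeff N ε nothing _ = 1#
    coeff N ε (just P) nothing = 1#
    coeff N ε (just P) (just Q) with P ≟ₚ Q
    ... | yes _ = - signF (N P)
    ... | no d  = signF (ε P Q d)

    δ : V → V → Carrier
    δ A B with A ≟ᵥ B
    ... | yes _ = 1#
    ... | no _  = 0#

    mul : NormMap → MultFactor → O → O → O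
    mul N ε Z W R = sumV λ A → sumV λ B → δ (A ⊕ B) R * coeff N ε A B * Z A * W B

    normO : NormMap → O → Carrier
    normO N Z = Z nothing * Z nothing + sumP λ P → signF (N P) * (Z (just P) * Z (just P))

    IsCompositionAlgebra : NormMap → MultFactor → Set (c ⊔ ℓ)
    IsCompositionAlgebra N ε = ∀ Z W → normO N (mul N ε Z W) ≈ normO N Z * normO N W

{-# OPTIONS --safe #-}
module Submission where

-- A dual vector n grades O_F by ℤ₂: write Z = X₀ + X₁, where X_i is the part of Z supported
-- on {n = i}. The product respects this grading, parts of different degree are orthogonal for
-- every norm, and twisting by n multiplies the norm on degree i by (-1)^i and the product of
-- homogeneous elements of degrees i, j by (-1)^(ij). So with p_ij = X_i Y_j the twisted product
-- of Z and W is (p₀₀ - p₁₁) + (p₀₁ + p₁₀), whose twisted norm is N(p₀₀ - p₁₁) - N(p₀₁ + p₁₀).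
-- This is (N X₀ - N X₁)(N Y₀ - N Y₁) up to the cross terms -2⟨p₀₀,p₁₁⟩ - 2⟨p₀₁,p₁₀⟩, and the
-- untwisted law N(ZW) = N(Z)N(W), applied to ZW = (p₀₀ + p₁₁) + (p₀₁ + p₁₀), says that these
-- cross terms vanish. Both parts of the theorem are this transfer, for the norm pairs (1, e^n)
-- and (e^n, 1).

open import Defs
open import Data.Bool using (Bool; true; false; _xor_; _∧_; if_then_else_)
open import Data.Bool.Properties using (∧-comm; ∧-idem; ∧-zeroʳ; xor-same) renaming (_≟_ to _≟ᵇ_)
open import Data.Sign using (opposite) renaming (_*_ to _*ˢ_; + to s+; - to s-)
open import Data.Product using (_×_; _,_)
open import Data.Maybe using (just; nothing)
open import Relation.Nullary using (yes; no; contradiction)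
open import Relation.Binary.PropositionalEquality as ≡ using (_≡_; _≢_)
open import Tactic.RingSolver.Core.AlmostCommutativeRing using (fromCommutativeRing)

*ˢ-opposite : ∀ s t → s *ˢ opposite t ≡ opposite (s *ˢ t)
*ˢ-opposite s+ t = ≡.refl
*ˢ-opposite s- t = ≡.refl

twist-isMultFactor : (Fa : FanoPlane) → let open FanoPlane Fa in
  ∀ n ε → IsMultFactor ε → IsMultFactor (twist n ε)
twist-isMultFactor Fa n ε isMF P Q P≢Q = ≡.trans
  (≡.cong₂ _*ˢ_ (≡.cong signOf (∧-comm (Dual.fun n (just Q)) (Dual.fun n (just P)))) (isMF P Q P≢Q))
  (*ˢ-opposite (signOf (Dual.fun n (just P) ∧ Dual.fun n (just Q))) (ε P Q P≢Q))
  where open FanoPlane Fa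

module _ {c ℓ} (Fa : FanoPlane) (𝔽 : Field c ℓ) where
  open FanoPlane Fa
  open Octonions 𝔽
  open Field 𝔽
  open import Algebra.Properties.Semiring.Sum semiring
    using (sum-cong-≋; sum-replicate-zero; ∑-distrib-+; *-distribˡ-sum)
  open import Algebra.Properties.CommutativeSemigroup +-commutativeSemigroup
    using () renaming (interchange to +-interchange)
  open import Algebra.Properties.CommutativeSemigroup *-commutativeSemigroup using (x∙yz≈y∙xz)
  open import Algebra.Properties.Group +-group using (ε⁻¹≈ε) renaming (∙-cancelˡ to +-cancelˡ)
  open import Algebra.Properties.AbelianGroup +-abelianGroup using (⁻¹-∙-comm)
  open import Algebra.Properties.Ring ring using (-1*x≈-x; -‿distribˡ-*; -‿distribʳ-*; -‿involutive)
  open import Relation.Binary.Reasoning.Setoid setoid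
  open import Tactic.RingSolver.NonReflective (fromCommutativeRing commutativeRing (λ _ → nothing))
    using (solve; _⊜_) renaming (_⊕_ to _:+_; _⊗_ to _:*_; ⊝_ to :-_)

  sumV-cong : ∀ {f g : V → Carrier} → (∀ A → f A ≈ g A) → sumV f ≈ sumV g
  sumV-cong f≈g = +-cong (f≈g nothing) (sum-cong-≋ (λ i → f≈g (just (pt i))))

  sumV-zero : ∀ {f : V → Carrier} → (∀ A → f A ≈ 0#) → sumV f ≈ 0#
  sumV-zero {f} f≈0 = begin
    sumV f             ≈⟨ sumV-cong f≈0 ⟩
    sumV (λ _ → 0#)    ≈⟨ +-identityˡ (sumP (λ _ → 0#)) ⟩
    sumP (λ _ → 0#)    ≈⟨ sum-replicate-zero 7 ⟩
    0#                 ∎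

  sumV-+ : ∀ (f g : V → Carrier) → sumV (λ A → f A + g A) ≈ sumV f + sumV g
  sumV-+ f g = trans (+-congˡ (∑-distrib-+ (λ i → f (just (pt i))) (λ i → g (just (pt i)))))
    (+-interchange (f nothing) (g nothing) (sumP (λ P → f (just P))) (sumP (λ P → g (just P))))

  sumV-split₄ : ∀ {f g h k l : V → Carrier} → (∀ A → f A ≈ g A + h A + (k A + l A)) →
    sumV f ≈ sumV g + sumV h + (sumV k + sumV l)
  sumV-split₄ {f} {g} {h} {k} {l} f≈ = begin
    sumV f                                          ≈⟨ sumV-cong f≈ ⟩
    sumV (λ A → g A + h A + (k A + l A))            ≈⟨ sumV-+ (λ A → g A + h A) (λ A → k A + l A) ⟩
    sumV (λ A → g A + h A) + sumV (λ A → k A + l A) ≈⟨ +-cong (sumV-+ g h) (sumV-+ k l) ⟩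
    sumV g + sumV h + (sumV k + sumV l)             ∎

  *-distribˡ-sumV : ∀ x (f : V → Carrier) → x * sumV f ≈ sumV (λ A → x * f A)
  *-distribˡ-sumV x f = trans (distribˡ x (f nothing) (sumP (λ P → f (just P))))
    (+-congˡ (*-distribˡ-sum x (λ i → f (just (pt i)))))

  sumV-neg : ∀ (f : V → Carrier) → sumV (λ A → - f A) ≈ - sumV f
  sumV-neg f = begin
    sumV (λ A → - f A)       ≈⟨ sumV-cong (λ A → sym (-1*x≈-x (f A))) ⟩
    sumV (λ A → - 1# * f A)  ≈⟨ *-distribˡ-sumV (- 1#) f ⟨
    - 1# * sumV f            ≈⟨ -1*x≈-x (sumV f) ⟩
    - sumV f                 ∎

  d≈0⇒d*k*x*y≈0 : ∀ {d} k x y → d ≈ 0# → d * k * x * y ≈ 0#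
  d≈0⇒d*k*x*y≈0 k x y d≈0 = trans (*-congʳ (*-congʳ (trans (*-congʳ d≈0) (zeroˡ k))))
    (trans (*-congʳ (zeroˡ x)) (zeroˡ y))

  x≈0⇒d*k*x*y≈0 : ∀ d k {x} y → x ≈ 0# → d * k * x * y ≈ 0#
  x≈0⇒d*k*x*y≈0 d k y x≈0 = trans (*-congʳ (trans (*-congˡ x≈0) (zeroʳ (d * k)))) (zeroˡ y)

  y≈0⇒d*k*x*y≈0 : ∀ d k x {y} → y ≈ 0# → d * k * x * y ≈ 0#
  y≈0⇒d*k*x*y≈0 d k x y≈0 = trans (*-congˡ y≈0) (zeroʳ (d * k * x))

  x≈0⇒w*[x*y]≈0 : ∀ w {x} y → x ≈ 0# → w * (x * y) ≈ 0#
  x≈0⇒w*[x*y]≈0 w y x≈0 = trans (*-congˡ (trans (*-congʳ x≈0) (zeroˡ y))) (zeroʳ w)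

  y≈0⇒w*[x*y]≈0 : ∀ w x {y} → y ≈ 0# → w * (x * y) ≈ 0#
  y≈0⇒w*[x*y]≈0 w x y≈0 = trans (*-congˡ (trans (*-congˡ y≈0) (zeroʳ x))) (zeroʳ w)

  -x*-y≈x*y : ∀ x y → (- x) * (- y) ≈ x * y
  -x*-y≈x*y x y = begin
    (- x) * (- y)  ≈⟨ -‿distribˡ-* x (- y) ⟨
    - (x * - y)    ≈⟨ -‿cong (-‿distribʳ-* x y) ⟨
    - - (x * y)    ≈⟨ -‿involutive (x * y) ⟩
    x * y          ∎

  sgn : Bool → Carrier
  sgn b = signF (signOf b)

  signF-*ˢ : ∀ s t → signF (s *ˢ t) ≈ signF s * signF t
  signF-*ˢ s+ t = sym (*-identityˡ _)
  signF-*ˢ s- s+ = sym (*-identityʳ _)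
  signF-*ˢ s- s- = sym (trans (-1*x≈-x (- 1#)) (-‿involutive 1#))

  sgn-square : ∀ b → sgn b * sgn b ≈ 1#
  sgn-square false = *-identityˡ 1#
  sgn-square true = trans (-1*x≈-x (- 1#)) (-‿involutive 1#)

  infixl 6 _+ᵒ_
  infix 4 _≋_

  _+ᵒ_ : O → O → O
  (X +ᵒ Y) A = X A + Y A

  -ᵒ_ : O → O
  (-ᵒ X) A = - X A

  _≋_ : O → O → Set ℓ
  X ≋ Y = ∀ A → X A ≈ Y A

  weight : NormMap → V → Carrier
  weight N nothing = 1#
  weight N (just P) = signF (N P)

  inner : NormMap → O → O → Carrier
  inner N X Y = sumV λ A → weight N A * (X A * Y A)

  normO≈inner : ∀ N X → normO N X ≈ inner N X X
  normO≈inner N X = +-congʳ (sym (*-identityˡ _))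

  module _ (N : NormMap) where

    normO-cong : ∀ {X Y} → X ≋ Y → normO N X ≈ normO N Y
    normO-cong {X} {Y} X≋Y = begin
      normO N X    ≈⟨ normO≈inner N X ⟩
      inner N X X  ≈⟨ sumV-cong (λ A → *-congˡ {weight N A} (*-cong (X≋Y A) (X≋Y A))) ⟩
      inner N Y Y  ≈⟨ normO≈inner N Y ⟨
      normO N Y    ∎

    normO-+ : ∀ X Y → normO N (X +ᵒ Y) ≈ normO N X + normO N Y + (inner N X Y + inner N X Y)
    normO-+ X Y = begin
      normO N (X +ᵒ Y)  ≈⟨ normO≈inner N (X +ᵒ Y) ⟩
      inner N (X +ᵒ Y) (X +ᵒ Y)
        ≈⟨ sumV-split₄ (λ A → expand (weight N A) (X A) (Y A)) ⟩
      inner N X X + inner N Y Y + (inner N X Y + inner N X Y)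
        ≈⟨ +-congʳ (+-cong (normO≈inner N X) (normO≈inner N Y)) ⟨
      normO N X + normO N Y + (inner N X Y + inner N X Y) ∎
      where
      -- over an arbitrary ring the solver cannot merge repeated monomials, so x and y are duplicated
      expand : ∀ w x y → w * ((x + y) * (x + y)) ≈ w * (x * x) + w * (y * y) + (w * (x * y) + w * (x * y))
      expand w x y = trans
        (solve 5 (λ w x y x′ y′ → (w :* ((x :+ y) :* (x′ :+ y′))) ⊜
                   (w :* (x :* x′) :+ w :* (y :* y′) :+ (w :* (x :* y′) :+ w :* (y :* x′)))) refl w x y x y)
        (+-congˡ (+-congˡ (*-congˡ (*-comm y x))))

    normO-neg : ∀ X → normO N (-ᵒ X) ≈ normO N X
    normO-neg X = begin
      normO N (-ᵒ X)      ≈⟨ normO≈inner N (-ᵒ X) ⟩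
      inner N (-ᵒ X) (-ᵒ X) ≈⟨ sumV-cong (λ A → *-congˡ {weight N A} (-x*-y≈x*y (X A) (X A))) ⟩
      inner N X X         ≈⟨ normO≈inner N X ⟨
      normO N X           ∎

    inner-negʳ : ∀ X Y → inner N X (-ᵒ Y) ≈ - inner N X Y
    inner-negʳ X Y = begin
      inner N X (-ᵒ Y)  ≈⟨ sumV-cong (λ A → sym (trans (-‿distribʳ-* (weight N A) (X A * Y A))
                                                     (*-congˡ (-‿distribʳ-* (X A) (Y A))))) ⟩
      sumV (λ A → - (weight N A * (X A * Y A))) ≈⟨ sumV-neg (λ A → weight N A * (X A * Y A)) ⟩
      - inner N X Y     ∎

    normO-+- : ∀ X Y → normO N (X +ᵒ -ᵒ Y) ≈ normO N X + normO N Y + - (inner N X Y + inner N X Y)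
    normO-+- X Y = begin
      normO N (X +ᵒ -ᵒ Y)
        ≈⟨ normO-+ X (-ᵒ Y) ⟩
      normO N X + normO N (-ᵒ Y) + (inner N X (-ᵒ Y) + inner N X (-ᵒ Y))
        ≈⟨ +-cong (+-congˡ (normO-neg Y)) (+-cong (inner-negʳ X Y) (inner-negʳ X Y)) ⟩
      normO N X + normO N Y + (- inner N X Y + - inner N X Y)
        ≈⟨ +-congˡ (⁻¹-∙-comm _ _) ⟩
      normO N X + normO N Y + - (inner N X Y + inner N X Y) ∎

  δ-≢ : ∀ {A B} → A ≢ B → δ A B ≈ 0#
  δ-≢ {A} {B} A≢B with A ≟ᵥ B
  ... | yes A≡B = contradiction A≡B A≢B
  ... | no _ = refl

  mul-split : ∀ N ε {Z W X₀ X₁ Y₀ Y₁} → Z ≋ X₀ +ᵒ X₁ → W ≋ Y₀ +ᵒ Y₁ →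
    mul N ε Z W ≋ mul N ε X₀ Y₀ +ᵒ mul N ε X₁ Y₁ +ᵒ (mul N ε X₀ Y₁ +ᵒ mul N ε X₁ Y₀)
  mul-split N ε {Z} {W} {X₀} {X₁} {Y₀} {Y₁} Z≋ W≋ R =
    sumV-split₄ (λ A → sumV-split₄ (λ B → expand (δ (A ⊕ B) R) (coeff N ε A B) (Z≋ A) (W≋ B)))
    where
    expand : ∀ d k {z w x₀ x₁ y₀ y₁} → z ≈ x₀ + x₁ → w ≈ y₀ + y₁ →
      d * k * z * w ≈ d * k * x₀ * y₀ + d * k * x₁ * y₁ + (d * k * x₀ * y₁ + d * k * x₁ * y₀)
    expand d k {x₀ = x₀} {x₁} {y₀} {y₁} z≈ w≈ = trans (*-cong (*-congˡ z≈) w≈)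
      (solve 6 (λ d k x₀ x₁ y₀ y₁ → (d :* k :* (x₀ :+ x₁) :* (y₀ :+ y₁)) ⊜
                 (d :* k :* x₀ :* y₀ :+ d :* k :* x₁ :* y₁ :+ (d :* k :* x₀ :* y₁ :+ d :* k :* x₁ :* y₀)))
        refl d k x₀ x₁ y₀ y₁)

  [x₀-x₁][y₀-y₁] : ∀ x₀ x₁ y₀ y₁ → (x₀ + - x₁) * (y₀ + - y₁) ≈ x₀ * y₀ + x₁ * y₁ + - (x₀ * y₁ + x₁ * y₀)
  [x₀-x₁][y₀-y₁] x₀ x₁ y₀ y₁ = begin
    (x₀ + - x₁) * (y₀ + - y₁)
      ≈⟨ solve 4 (λ x₀ x₁ y₀ y₁ → ((x₀ :+ :- x₁) :* (y₀ :+ :- y₁)) ⊜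
                   (x₀ :* y₀ :+ (:- x₁) :* (:- y₁) :+ (x₀ :* (:- y₁) :+ (:- x₁) :* y₀))) refl x₀ x₁ y₀ y₁ ⟩
    x₀ * y₀ + (- x₁) * (- y₁) + (x₀ * (- y₁) + (- x₁) * y₀)
      ≈⟨ +-cong (+-congˡ (-x*-y≈x*y x₁ y₁)) (+-cong (sym (-‿distribʳ-* x₀ y₁)) (sym (-‿distribˡ-* x₁ y₀))) ⟩
    x₀ * y₀ + x₁ * y₁ + (- (x₀ * y₁) + - (x₁ * y₀))
      ≈⟨ +-congˡ (⁻¹-∙-comm (x₀ * y₁) (x₁ * y₀)) ⟩
    x₀ * y₀ + x₁ * y₁ + - (x₀ * y₁ + x₁ * y₀) ∎

  cross-terms-cancel : ∀ {x₀ x₁ y₀ y₁ p₀₀ p₁₁ p₀₁ p₁₀} s t →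
    p₀₀ ≈ x₀ * y₀ → p₁₁ ≈ x₁ * y₁ → p₀₁ ≈ x₀ * y₁ → p₁₀ ≈ x₁ * y₀ →
    (p₀₀ + p₁₁ + s) + (p₀₁ + p₁₀ + t) ≈ (x₀ + x₁) * (y₀ + y₁) →
    (p₀₀ + p₁₁ + - s) + - (p₀₁ + p₁₀ + t) ≈ (x₀ + - x₁) * (y₀ + - y₁)
  cross-terms-cancel {x₀} {x₁} {y₀} {y₁} {p₀₀} {p₁₁} {p₀₁} {p₁₀} s t p₀₀≈ p₁₁≈ p₀₁≈ p₁₀≈ untwisted = begin
    (p₀₀ + p₁₁ + - s) + - (p₀₁ + p₁₀ + t)
      ≈⟨ solve 4 (λ P Q s t → ((P :+ :- s) :+ :- (Q :+ t)) ⊜ ((P :+ :- Q) :+ :- (s :+ t)))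
           refl (p₀₀ + p₁₁) (p₀₁ + p₁₀) s t ⟩
    (p₀₀ + p₁₁) + - (p₀₁ + p₁₀) + - (s + t)
      ≈⟨ +-cong (+-cong (+-cong p₀₀≈ p₁₁≈) (-‿cong (+-cong p₀₁≈ p₁₀≈))) (trans (-‿cong s+t≈0) ε⁻¹≈ε) ⟩
    (x₀ * y₀ + x₁ * y₁) + - (x₀ * y₁ + x₁ * y₀) + 0#
      ≈⟨ +-identityʳ _ ⟩
    (x₀ * y₀ + x₁ * y₁) + - (x₀ * y₁ + x₁ * y₀)
      ≈⟨ [x₀-x₁][y₀-y₁] x₀ x₁ y₀ y₁ ⟨
    (x₀ + - x₁) * (y₀ + - y₁) ∎
    where
    s+t≈0 : s + t ≈ 0#
    s+t≈0 = +-cancelˡ ((x₀ + x₁) * (y₀ + y₁)) (s + t) 0# (begin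
      (x₀ + x₁) * (y₀ + y₁) + (s + t)
        ≈⟨ solve 6 (λ x₀ x₁ y₀ y₁ s t → ((x₀ :+ x₁) :* (y₀ :+ y₁) :+ (s :+ t)) ⊜
                     ((x₀ :* y₀ :+ x₁ :* y₁ :+ s) :+ (x₀ :* y₁ :+ x₁ :* y₀ :+ t))) refl x₀ x₁ y₀ y₁ s t ⟩
      (x₀ * y₀ + x₁ * y₁ + s) + (x₀ * y₁ + x₁ * y₀ + t)
        ≈⟨ +-cong (+-congʳ (+-cong p₀₀≈ p₁₁≈)) (+-congʳ (+-cong p₀₁≈ p₁₀≈)) ⟨
      (p₀₀ + p₁₁ + s) + (p₀₁ + p₁₀ + t)
        ≈⟨ untwisted ⟩
      (x₀ + x₁) * (y₀ + y₁)
        ≈⟨ +-identityʳ _ ⟨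
      (x₀ + x₁) * (y₀ + y₁) + 0# ∎)

  module Graded (n : Dual) where

    deg : V → Bool
    deg = Dual.fun n

    deg-nothing : deg nothing ≡ false
    deg-nothing = ≡.trans (Dual.additive n nothing nothing) (xor-same (deg nothing))

    Homogeneous : Bool → O → Set ℓ
    Homogeneous i X = ∀ A → deg A ≢ i → X A ≈ 0#

    homogeneous-+ : ∀ {i X Y} → Homogeneous i X → Homogeneous i Y → Homogeneous i (X +ᵒ Y)
    homogeneous-+ X-hom Y-hom A A≢i = trans (+-cong (X-hom A A≢i) (Y-hom A A≢i)) (+-identityʳ 0#)

    homogeneous-neg : ∀ {i X} → Homogeneous i X → Homogeneous i (-ᵒ X)
    homogeneous-neg X-hom A A≢i = trans (-‿cong (X-hom A A≢i)) ε⁻¹≈ε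

    part : Bool → O → O
    part i X A = if deg A xor i then 0# else X A

    part-homogeneous : ∀ i X → Homogeneous i (part i X)
    part-homogeneous false X A A≢false with deg A
    ... | false = contradiction ≡.refl A≢false
    ... | true = refl
    part-homogeneous true X A A≢true with deg A
    ... | false = refl
    ... | true = contradiction ≡.refl A≢true

    part-split : ∀ X → X ≋ part false X +ᵒ part true X
    part-split X A with deg A
    ... | false = sym (+-identityʳ (X A))
    ... | true = sym (+-identityˡ (X A))

    mul-homogeneous : ∀ N ε {i j X Y} → Homogeneous i X → Homogeneous j Y → Homogeneous (i xor j) (mul N ε X Y)
    mul-homogeneous N ε {i} {j} {X} {Y} X-hom Y-hom R R≢ = sumV-zero (λ A → sumV-zero (λ B → term≈0 A B))
      where
      term≈0 : ∀ A B → δ (A ⊕ B) R * coeff N ε A B * X A * Y B ≈ 0#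
      term≈0 A B with deg A ≟ᵇ i | deg B ≟ᵇ j
      ... | no A≢i | _ = x≈0⇒d*k*x*y≈0 (δ (A ⊕ B) R) (coeff N ε A B) (Y B) (X-hom A A≢i)
      ... | yes _ | no B≢j = y≈0⇒d*k*x*y≈0 (δ (A ⊕ B) R) (coeff N ε A B) (X A) (Y-hom B B≢j)
      ... | yes A≡i | yes B≡j = d≈0⇒d*k*x*y≈0 (coeff N ε A B) (X A) (Y B) (δ-≢ λ A⊕B≡R → R≢
        (≡.trans (≡.cong deg (≡.sym A⊕B≡R)) (≡.trans (Dual.additive n A B) (≡.cong₂ _xor_ A≡i B≡j))))

    inner-homogeneous : ∀ N {i j X Y} → i ≢ j → Homogeneous i X → Homogeneous j Y → inner N X Y ≈ 0#
    inner-homogeneous N {i} {j} {X} {Y} i≢j X-hom Y-hom = sumV-zero term≈0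
      where
      term≈0 : ∀ A → weight N A * (X A * Y A) ≈ 0#
      term≈0 A with deg A ≟ᵇ i
      ... | yes A≡i = y≈0⇒w*[x*y]≈0 (weight N A) (X A) (Y-hom A (λ A≡j → i≢j (≡.trans (≡.sym A≡i) A≡j)))
      ... | no A≢i = x≈0⇒w*[x*y]≈0 (weight N A) (Y A) (X-hom A A≢i)

    normO-homogeneous-+ : ∀ N {X Y} → Homogeneous false X → Homogeneous true Y →
      normO N (X +ᵒ Y) ≈ normO N X + normO N Y
    normO-homogeneous-+ N {X} {Y} X-hom Y-hom = begin
      normO N (X +ᵒ Y)                                     ≈⟨ normO-+ N X Y ⟩
      normO N X + normO N Y + (inner N X Y + inner N X Y)  ≈⟨ +-congˡ (+-cong X⊥Y X⊥Y) ⟩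
      normO N X + normO N Y + (0# + 0#)                    ≈⟨ +-congˡ (+-identityʳ 0#) ⟩
      normO N X + normO N Y + 0#                           ≈⟨ +-identityʳ _ ⟩
      normO N X + normO N Y                                ∎
      where
      X⊥Y : inner N X Y ≈ 0#
      X⊥Y = inner-homogeneous N (λ ()) X-hom Y-hom

    normO-parts : ∀ N X → normO N X ≈ normO N (part false X) + normO N (part true X)
    normO-parts N X = trans (normO-cong N (part-split X))
      (normO-homogeneous-+ N (part-homogeneous false X) (part-homogeneous true X))

    IsTwistOf : NormMap → NormMap → Set ℓ
    IsTwistOf N₁ N₂ = ∀ P → signF (N₁ P) ≈ sgn (deg (just P)) * signF (N₂ P)

    oneN-isTwistOf-expN : IsTwistOf oneN (expN n)
    oneN-isTwistOf-expN P = sym (sgn-square (deg (just P)))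

    expN-isTwistOf-oneN : IsTwistOf (expN n) oneN
    expN-isTwistOf-oneN P = sym (*-identityʳ _)

    module _ {N₁ N₂ : NormMap} (N₁-twist : IsTwistOf N₁ N₂) where

      weight-twist : ∀ A → weight N₁ A ≈ sgn (deg A) * weight N₂ A
      weight-twist nothing rewrite deg-nothing = sym (*-identityˡ 1#)
      weight-twist (just P) = N₁-twist P

      coeff-twist : ∀ ε A B → coeff N₁ (twist n ε) A B ≈ sgn (deg A ∧ deg B) * coeff N₂ ε A B
      coeff-twist ε nothing B rewrite deg-nothing = sym (*-identityˡ 1#)
      coeff-twist ε (just P) nothing rewrite deg-nothing | ∧-zeroʳ (deg (just P)) = sym (*-identityˡ 1#)
      coeff-twist ε (just P) (just Q) with P ≟ₚ Q
      ... | yes ≡.refl rewrite ∧-idem (deg (just P)) =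
        trans (-‿cong (N₁-twist P)) (-‿distribʳ-* (sgn (deg (just P))) (signF (N₂ P)))
      ... | no P≢Q = signF-*ˢ (signOf (deg (just P) ∧ deg (just Q))) (ε P Q P≢Q)

      mul-twist-homogeneous : ∀ ε {i j X Y} → Homogeneous i X → Homogeneous j Y →
        ∀ R → mul N₁ (twist n ε) X Y R ≈ sgn (i ∧ j) * mul N₂ ε X Y R
      mul-twist-homogeneous ε {i} {j} {X} {Y} X-hom Y-hom R = begin
        mul N₁ (twist n ε) X Y R                   ≈⟨ sumV-cong (λ A → sumV-cong (term A)) ⟩
        sumV (λ A → sumV (λ B → s * t A B))        ≈⟨ sumV-cong (λ A → *-distribˡ-sumV s (t A)) ⟨
        sumV (λ A → s * sumV (t A))                ≈⟨ *-distribˡ-sumV s (λ A → sumV (t A)) ⟨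
        s * mul N₂ ε X Y R                         ∎
        where
        s : Carrier
        s = sgn (i ∧ j)
        t : V → V → Carrier
        t A B = δ (A ⊕ B) R * coeff N₂ ε A B * X A * Y B
        both≈0 : ∀ {u v} → u ≈ 0# → v ≈ 0# → u ≈ s * v
        both≈0 u≈0 v≈0 = trans u≈0 (sym (trans (*-congˡ v≈0) (zeroʳ s)))
        term : ∀ A B → δ (A ⊕ B) R * coeff N₁ (twist n ε) A B * X A * Y B ≈ s * t A B
        term A B with deg A ≟ᵇ i | deg B ≟ᵇ j
        ... | no A≢i | _ = both≈0 (x≈0⇒d*k*x*y≈0 _ _ (Y B) (X-hom A A≢i)) (x≈0⇒d*k*x*y≈0 _ _ (Y B) (X-hom A A≢i))
        ... | yes _ | no B≢j = both≈0 (y≈0⇒d*k*x*y≈0 _ _ (X A) (Y-hom B B≢j)) (y≈0⇒d*k*x*y≈0 _ _ (X A) (Y-hom B B≢j))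
        ... | yes A≡i | yes B≡j = begin
          d * coeff N₁ (twist n ε) A B * X A * Y B  ≈⟨ *-congʳ (*-congʳ (*-congˡ (coeff-twist ε A B))) ⟩
          d * (sgn (deg A ∧ deg B) * k) * X A * Y B ≡⟨ ≡.cong (λ b → d * (sgn b * k) * X A * Y B) (≡.cong₂ _∧_ A≡i B≡j) ⟩
          d * (s * k) * X A * Y B                   ≈⟨ *-congʳ (*-congʳ (x∙yz≈y∙xz d s k)) ⟩
          s * (d * k) * X A * Y B                   ≈⟨ *-congʳ (*-assoc s (d * k) (X A)) ⟩
          s * (d * k * X A) * Y B                   ≈⟨ *-assoc s (d * k * X A) (Y B) ⟩
          s * t A B                                 ∎
          where
          d k : Carrier
          d = δ (A ⊕ B) R
          k = coeff N₂ ε A B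

      normO-twist-homogeneous : ∀ {i X} → Homogeneous i X → normO N₁ X ≈ sgn i * normO N₂ X
      normO-twist-homogeneous {i} {X} X-hom = begin
        normO N₁ X                                         ≈⟨ normO≈inner N₁ X ⟩
        inner N₁ X X                                       ≈⟨ sumV-cong term ⟩
        sumV (λ A → sgn i * (weight N₂ A * (X A * X A)))   ≈⟨ *-distribˡ-sumV (sgn i) (λ A → weight N₂ A * (X A * X A)) ⟨
        sgn i * inner N₂ X X                               ≈⟨ *-congˡ (normO≈inner N₂ X) ⟨
        sgn i * normO N₂ X                                 ∎
        where
        term : ∀ A → weight N₁ A * (X A * X A) ≈ sgn i * (weight N₂ A * (X A * X A))
        term A with deg A ≟ᵇ i
        ... | yes A≡i = begin
          weight N₁ A * (X A * X A)                  ≈⟨ *-congʳ (weight-twist A) ⟩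
          sgn (deg A) * weight N₂ A * (X A * X A)    ≡⟨ ≡.cong (λ b → sgn b * weight N₂ A * (X A * X A)) A≡i ⟩
          sgn i * weight N₂ A * (X A * X A)          ≈⟨ *-assoc (sgn i) (weight N₂ A) (X A * X A) ⟩
          sgn i * (weight N₂ A * (X A * X A))        ∎
        ... | no A≢i = trans (x≈0⇒w*[x*y]≈0 (weight N₁ A) (X A) (X-hom A A≢i))
          (sym (trans (*-congˡ (x≈0⇒w*[x*y]≈0 (weight N₂ A) (X A) (X-hom A A≢i))) (zeroʳ (sgn i))))

      normO-twist-split : ∀ {X Y} → Homogeneous false X → Homogeneous true Y →
        normO N₁ (X +ᵒ Y) ≈ normO N₂ X + - normO N₂ Y
      normO-twist-split {X} {Y} X-hom Y-hom = begin
        normO N₁ (X +ᵒ Y)                            ≈⟨ normO-homogeneous-+ N₁ X-hom Y-hom ⟩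
        normO N₁ X + normO N₁ Y                      ≈⟨ +-cong (normO-twist-homogeneous X-hom) (normO-twist-homogeneous Y-hom) ⟩
        sgn false * normO N₂ X + sgn true * normO N₂ Y ≈⟨ +-cong (*-identityˡ (normO N₂ X)) (-1*x≈-x (normO N₂ Y)) ⟩
        normO N₂ X + - normO N₂ Y                    ∎

      normO-twist-parts : ∀ X → normO N₁ X ≈ normO N₂ (part false X) + - normO N₂ (part true X)
      normO-twist-parts X = trans (normO-cong N₁ (part-split X))
        (normO-twist-split (part-homogeneous false X) (part-homogeneous true X))

      module Expansion (ε : MultFactor) (Z W : O) where

        X₀ X₁ Y₀ Y₁ p₀₀ p₀₁ p₁₀ p₁₁ : O
        X₀ = part false Z
        X₁ = part true Z
        Y₀ = part false W
        Y₁ = part true W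
        p₀₀ = mul N₂ ε X₀ Y₀
        p₀₁ = mul N₂ ε X₀ Y₁
        p₁₀ = mul N₂ ε X₁ Y₀
        p₁₁ = mul N₂ ε X₁ Y₁

        p-homogeneous : ∀ i j → Homogeneous (i xor j) (mul N₂ ε (part i Z) (part j W))
        p-homogeneous i j = mul-homogeneous N₂ ε (part-homogeneous i Z) (part-homogeneous j W)

        p-twist : ∀ i j R →
          mul N₁ (twist n ε) (part i Z) (part j W) R ≈ sgn (i ∧ j) * mul N₂ ε (part i Z) (part j W) R
        p-twist i j = mul-twist-homogeneous ε (part-homogeneous i Z) (part-homogeneous j W)

        untwisted-expansion : mul N₂ ε Z W ≋ p₀₀ +ᵒ p₁₁ +ᵒ (p₀₁ +ᵒ p₁₀)
        untwisted-expansion = mul-split N₂ ε (part-split Z) (part-split W)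

        twisted-expansion : mul N₁ (twist n ε) Z W ≋ p₀₀ +ᵒ -ᵒ p₁₁ +ᵒ (p₀₁ +ᵒ p₁₀)
        twisted-expansion R = trans (mul-split N₁ (twist n ε) (part-split Z) (part-split W) R)
          (+-cong (+-cong (trans (p-twist false false R) (*-identityˡ (p₀₀ R)))
                          (trans (p-twist true true R) (-1*x≈-x (p₁₁ R))))
                  (+-cong (trans (p-twist false true R) (*-identityˡ (p₀₁ R)))
                          (trans (p-twist true false R) (*-identityˡ (p₁₀ R)))))

      twist-isCompositionAlgebra : ∀ ε → IsCompositionAlgebra N₂ ε → IsCompositionAlgebra N₁ (twist n ε)
      twist-isCompositionAlgebra ε comp Z W = begin
        normO N₁ (mul N₁ (twist n ε) Z W)          ≈⟨ normO-cong N₁ twisted-expansion ⟩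
        normO N₁ (p₀₀ +ᵒ -ᵒ p₁₁ +ᵒ (p₀₁ +ᵒ p₁₀))  ≈⟨ normO-twist-split even odd ⟩
        ‖ p₀₀ +ᵒ -ᵒ p₁₁ ‖ + - ‖ p₀₁ +ᵒ p₁₀ ‖
          ≈⟨ +-cong (normO-+- N₂ p₀₀ p₁₁) (-‿cong (normO-+ N₂ p₀₁ p₁₀)) ⟩
        (‖ p₀₀ ‖ + ‖ p₁₁ ‖ + - (s + s)) + - (‖ p₀₁ ‖ + ‖ p₁₀ ‖ + (t + t))
          ≈⟨ cross-terms-cancel (s + s) (t + t) (comp X₀ Y₀) (comp X₁ Y₁) (comp X₀ Y₁) (comp X₁ Y₀) untwisted ⟩
        (‖ X₀ ‖ + - ‖ X₁ ‖) * (‖ Y₀ ‖ + - ‖ Y₁ ‖)  ≈⟨ *-cong (normO-twist-parts Z) (normO-twist-parts W) ⟨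
        normO N₁ Z * normO N₁ W                    ∎
        where
        open Expansion ε Z W

        ‖_‖ : O → Carrier
        ‖_‖ = normO N₂

        s t : Carrier
        s = inner N₂ p₀₀ p₁₁
        t = inner N₂ p₀₁ p₁₀

        even : Homogeneous false (p₀₀ +ᵒ -ᵒ p₁₁)
        even = homogeneous-+ (p-homogeneous false false) (homogeneous-neg (p-homogeneous true true))

        odd : Homogeneous true (p₀₁ +ᵒ p₁₀)
        odd = homogeneous-+ (p-homogeneous false true) (p-homogeneous true false)

        untwisted : (‖ p₀₀ ‖ + ‖ p₁₁ ‖ + (s + s)) + (‖ p₀₁ ‖ + ‖ p₁₀ ‖ + (t + t))
                    ≈ (‖ X₀ ‖ + ‖ X₁ ‖) * (‖ Y₀ ‖ + ‖ Y₁ ‖)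
        untwisted = begin
          (‖ p₀₀ ‖ + ‖ p₁₁ ‖ + (s + s)) + (‖ p₀₁ ‖ + ‖ p₁₀ ‖ + (t + t))
            ≈⟨ +-cong (normO-+ N₂ p₀₀ p₁₁) (normO-+ N₂ p₀₁ p₁₀) ⟨
          ‖ p₀₀ +ᵒ p₁₁ ‖ + ‖ p₀₁ +ᵒ p₁₀ ‖
            ≈⟨ normO-homogeneous-+ N₂ (homogeneous-+ (p-homogeneous false false) (p-homogeneous true true)) odd ⟨
          ‖ p₀₀ +ᵒ p₁₁ +ᵒ (p₀₁ +ᵒ p₁₀) ‖           ≈⟨ normO-cong N₂ untwisted-expansion ⟨
          ‖ mul N₂ ε Z W ‖                         ≈⟨ comp Z W ⟩
          ‖ Z ‖ * ‖ W ‖                            ≈⟨ *-cong (normO-parts N₂ Z) (normO-parts N₂ W) ⟩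
          (‖ X₀ ‖ + ‖ X₁ ‖) * (‖ Y₀ ‖ + ‖ Y₁ ‖)   ∎

lemma4p6 : ∀ {c ℓ} (Fa : FanoPlane) (𝔽 : Field c ℓ) → CharNot2 𝔽 →
    let open FanoPlane Fa in let open Octonions 𝔽 in
    (∀ (n′ : Dual) (ε′ : MultFactor) → IsMultFactor ε′ → IsCompositionAlgebra (expN n′) ε′ →
      IsMultFactor (twist n′ ε′) × IsCompositionAlgebra oneN (twist n′ ε′))
    × (∀ (ε : MultFactor) → IsMultFactor ε → IsCompositionAlgebra oneN ε → (n′ : Dual) →
      IsMultFactor (twist n′ ε) × IsCompositionAlgebra (expN n′) (twist n′ ε))
-- no division by 2 occurs
lemma4p6 Fa 𝔽 _ =
  (λ n′ ε′ ε′-isMF comp → twist-isMultFactor Fa n′ ε′ ε′-isMF ,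
     twist-isCompositionAlgebra n′ (oneN-isTwistOf-expN n′) ε′ comp) ,
  (λ ε ε-isMF comp n′ → twist-isMultFactor Fa n′ ε ε-isMF ,
     twist-isCompositionAlgebra n′ (expN-isTwistOf-oneN n′) ε comp)
  where open Graded Fa 𝔽
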